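{- Fix integers $a,b$ (not necessarily positive) and a positive integer $n$. Let $X_1,X_2,\dots$ be i.i.d. random variables with $P(X_i=a)=P(X_i=b)=\tfrac12$, let $S_0=0$ and $S_k=X_1+\dots+X_k$. Define, for $k\ge 0$, $q(n,k)=P(S_j<n \text{ for all } j=0,1,\dots,k)$, and for $k\ge1$, $r(n,k)=P(S_k\ge n \text{ and } S_j<n \text{ for all } j=0,1,\dots,k-1)$. Let $p_n=\sum_{k=1}^{\infty} q(n,k)\, r(n,k)$. If $\lim_{k\to\infty} q(n,k)=0$, then \[ p_n=\frac12-\frac12\sum_{k=1}^{\infty} r(n,k)^2 .\]
   Context: Game interpretation: two players, the first player $A$ and the second player $B$, alternately (A first in each round) add $a$ or $b$ chips, each with probability $1/2$ and independently, to their own piles (both starting from $0$ chips; piles may be negative). The first player whose pile reaches at least $n$ chips wins. $S_k$ models a player's pile after his $k$-th move; $q(n,k)$ is the probability a player has not reached $n$ chips by his $k$-th move, $r(n,k)$ the probability he first reaches at least $n$ chips on his $k$-th move, and $p_n$ is the probability that the second player wins. -}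

module Defs where

open import Data.Bool using (Bool; true; false; _∧_; not; if_then_else_)
open import Data.Nat as ℕ using (ℕ; zero; suc; _^_)
open import Data.Nat.Properties using (m^n≢0)
open import Data.Integer as ℤ using (ℤ; +_)
open import Data.Rational as ℚ using (ℚ; _/_; 0ℚ; ½; ∣_∣)
open import Data.List using (List; []; _∷_; map; _++_)
open import Data.Nat.ListAction using (sum)
open import Data.Product using (∃; Σ; _×_)
open import Relation.Nullary.Decidable using (⌊_⌋)

step : (a b : ℤ) → Bool → ℤ
step a b true  = a
step a b false = b

-- All 2^k equally likely move sequences (X_1, …, X_k).
paths : ℕ → List (List Bool)
paths zero    = [] ∷ []
paths (suc k) = map (true ∷_) (paths k) ++ map (false ∷_) (paths k)

staysBelow : (a b n s : ℤ) → List Bool → Bool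
staysBelow a b n s []       = ⌊ s ℤ.<? n ⌋
staysBelow a b n s (x ∷ xs) = ⌊ s ℤ.<? n ⌋ ∧ staysBelow a b n (s ℤ.+ step a b x) xs

firstHits : (a b n s : ℤ) → List Bool → Bool
firstHits a b n s []       = not ⌊ s ℤ.<? n ⌋
firstHits a b n s (x ∷ xs) = ⌊ s ℤ.<? n ⌋ ∧ firstHits a b n (s ℤ.+ step a b x) xs

count : {A : Set} → (A → Bool) → List A → ℕ
count f xs = sum (map (λ x → if f x then 1 else 0) xs)

prob : (k : ℕ) → (List Bool → Bool) → ℚ
prob k f = _/_ (+ count f (paths k)) (2 ^ k) {{m^n≢0 2 k}}

q : (a b : ℤ) (n k : ℕ) → ℚ
q a b n k = prob k (staysBelow a b (+ n) (+ 0))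

r : (a b : ℤ) (n k : ℕ) → ℚ
r a b n k = prob k (firstHits a b (+ n) (+ 0))

Σ₁ : (ℕ → ℚ) → ℕ → ℚ
Σ₁ f zero    = 0ℚ
Σ₁ f (suc N) = Σ₁ f N ℚ.+ f (suc N)

TendsTo : (ℕ → ℚ) → ℚ → Set
TendsTo s L = ∀ (ε : ℚ) → 0ℚ ℚ.< ε → ∃ λ N → ∀ k → N ℕ.≤ k → ∣ s k ℚ.- L ∣ ℚ.< ε

-- a rational sequence is Cauchy (i.e. converges in ℝ)
IsCauchy : (ℕ → ℚ) → Set
IsCauchy s = ∀ (ε : ℚ) → 0ℚ ℚ.< ε → ∃ λ N → ∀ j k → N ℕ.≤ j → N ℕ.≤ k → ∣ s j ℚ.- s k ∣ ℚ.< ε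

pPartial : (a b : ℤ) (n : ℕ) → ℕ → ℚ
pPartial a b n = Σ₁ (λ k → q a b n k ℚ.* r a b n k)

r²Partial : (a b : ℤ) (n : ℕ) → ℕ → ℚ
r²Partial a b n = Σ₁ (λ k → r a b n k ℚ.* r a b n k)

-- Appending one move to a path that has stayed below n either keeps it below n or makes
-- it reach n for the first time, so q(n,k) = q(n,k+1) + r(n,k+1).  Squaring this and
-- telescoping gives 2 Σ_{k≤N} q(n,k) r(n,k) + Σ_{k≤N} r(n,k)² + q(n,N)² = q(n,0)² = 1.
-- Both partial sums are increasing and their tails from j on are at most q(n,j)² ≤ q(n,j),
-- so they are Cauchy once q(n,k) → 0, and p_N − (½ − ½ Σ_{k≤N} r(n,k)²) = −½ q(n,N)² → 0.

module Submission where

module PathCounts where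

  import Algebra.Properties.CommutativeSemigroup
  open import Data.Bool using (Bool; true; false; _∧_; not; if_then_else_)
  open import Data.List using ([]; _∷_; _∷ʳ_; map; _++_)
  open import Data.List.Properties using (map-++; map-∘)
  open import Data.Nat as ℕ using (ℕ; zero; suc; _+_)
  open import Data.Nat.ListAction using (sum)
  open import Data.Nat.ListAction.Properties using (sum-++)
  import Data.Nat.Properties as ℕ
  open import Data.Integer as ℤ using (ℤ)
  open import Function using (_∘_)
  open import Relation.Nullary.Decidable using (⌊_⌋)
  open import Relation.Binary.PropositionalEquality
  open ≡-Reasoning

  open import Defs

  open Algebra.Properties.CommutativeSemigroup ℕ.+-commutativeSemigroup using (interchange)

  ι : Bool → ℕ
  ι c = if c then 1 else 0

  ι-split : ∀ c d → ι c ≡ ι (c ∧ d) + ι (c ∧ not d)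
  ι-split true  true  = refl
  ι-split true  false = refl
  ι-split false _     = refl

  count-++ : ∀ {A : Set} (f : A → Bool) xs ys →
             count f (xs ++ ys) ≡ count f xs + count f ys
  count-++ f xs ys = trans (cong sum (map-++ _ xs ys)) (sum-++ (map (ι ∘ f) xs) _)

  count-map : ∀ {A B : Set} (f : B → Bool) (g : A → B) xs →
              count f (map g xs) ≡ count (f ∘ g) xs
  count-map f g xs = cong sum (sym (map-∘ xs))

  count-partition : ∀ {A : Set} {f g h : A → Bool} → (∀ x → ι (h x) ≡ ι (f x) + ι (g x)) →
                    ∀ xs → count h xs ≡ count f xs + count g xs
  count-partition h≡f+g []       = refl
  count-partition {f = f} {g} {h} h≡f+g (x ∷ xs) = begin
    ι (h x) + count h xs
      ≡⟨ cong₂ _+_ (h≡f+g x) (count-partition h≡f+g xs) ⟩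
    (ι (f x) + ι (g x)) + (count f xs + count g xs)
      ≡⟨ interchange (ι (f x)) (ι (g x)) (count f xs) _ ⟩
    (ι (f x) + count f xs) + (ι (g x) + count g xs) ∎

  count-paths-suc-∷ : ∀ f k → count f (paths (suc k)) ≡
    count (f ∘ (true ∷_)) (paths k) + count (f ∘ (false ∷_)) (paths k)
  count-paths-suc-∷ f k = trans (count-++ f (map (true ∷_) (paths k)) _)
    (cong₂ _+_ (count-map f (true ∷_) (paths k)) (count-map f (false ∷_) (paths k)))

  count-paths-suc-∷ʳ : ∀ f k → count f (paths (suc k)) ≡
    count (f ∘ (_∷ʳ true)) (paths k) + count (f ∘ (_∷ʳ false)) (paths k)
  count-paths-suc-∷ʳ f zero    =
    cong (_+ (ι (f (false ∷ [])) + 0)) (sym (ℕ.+-identityʳ (ι (f (true ∷ [])))))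
  count-paths-suc-∷ʳ f (suc k) = begin
    count f (paths (suc (suc k)))
      ≡⟨ count-paths-suc-∷ f (suc k) ⟩
    count (f ∘ (true ∷_)) (paths (suc k)) + count (f ∘ (false ∷_)) (paths (suc k))
      ≡⟨ cong₂ _+_ (count-paths-suc-∷ʳ (f ∘ (true ∷_)) k)
                   (count-paths-suc-∷ʳ (f ∘ (false ∷_)) k) ⟩
    (tt + tf) + (ft + ff)
      ≡⟨ interchange tt tf ft ff ⟩
    (tt + ft) + (tf + ff)
      ≡⟨ cong₂ _+_ (count-paths-suc-∷ (f ∘ (_∷ʳ true)) k)
                   (count-paths-suc-∷ (f ∘ (_∷ʳ false)) k) ⟨
    count (f ∘ (_∷ʳ true)) (paths (suc k)) + count (f ∘ (_∷ʳ false)) (paths (suc k)) ∎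
    where
    tt tf ft ff : ℕ
    tt = count (f ∘ (true ∷_) ∘ (_∷ʳ true)) (paths k)
    tf = count (f ∘ (true ∷_) ∘ (_∷ʳ false)) (paths k)
    ft = count (f ∘ (false ∷_) ∘ (_∷ʳ true)) (paths k)
    ff = count (f ∘ (false ∷_) ∘ (_∷ʳ false)) (paths k)

  module _ (a b N : ℤ) where

    staysBelow-partition : ∀ s xs x → ι (staysBelow a b N s xs) ≡
      ι (staysBelow a b N s (xs ∷ʳ x)) + ι (firstHits a b N s (xs ∷ʳ x))
    staysBelow-partition s []       x = ι-split ⌊ s ℤ.<? N ⌋ ⌊ s ℤ.+ step a b x ℤ.<? N ⌋
    staysBelow-partition s (y ∷ ys) x with ⌊ s ℤ.<? N ⌋
    ... | true  = staysBelow-partition (s ℤ.+ step a b y) ys x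
    ... | false = refl

    count-staysBelow-suc : ∀ s k →
      2 ℕ.* count (staysBelow a b N s) (paths k) ≡
      count (staysBelow a b N s) (paths (suc k)) + count (firstHits a b N s) (paths (suc k))
    count-staysBelow-suc s k = begin
      2 ℕ.* C k
        ≡⟨ cong (C k +_) (ℕ.+-identityʳ (C k)) ⟩
      C k + C k
        ≡⟨ cong₂ _+_ (count-partition (λ xs → staysBelow-partition s xs true) (paths k))
                     (count-partition (λ xs → staysBelow-partition s xs false) (paths k)) ⟩
      (stays true + hits true) + (stays false + hits false)
        ≡⟨ interchange (stays true) (hits true) (stays false) (hits false) ⟩
      (stays true + stays false) + (hits true + hits false)
        ≡⟨ cong₂ _+_ (count-paths-suc-∷ʳ (staysBelow a b N s) k)
                     (count-paths-suc-∷ʳ (firstHits a b N s) k) ⟨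
      C (suc k) + count (firstHits a b N s) (paths (suc k)) ∎
      where
      C : ℕ → ℕ
      C k = count (staysBelow a b N s) (paths k)
      stays hits : Bool → ℕ
      stays x = count (λ xs → staysBelow a b N s (xs ∷ʳ x)) (paths k)
      hits  x = count (λ xs → firstHits a b N s (xs ∷ʳ x)) (paths k)

module Fractions where

  open import Data.Nat as ℕ using (ℕ; suc)
  open import Data.Integer as ℤ using (ℤ; +_)
  import Data.Integer.Properties as ℤ
  open import Data.Rational as ℚ using (ℚ; _/_; fromℚᵘ; toℚᵘ; _+_)
  open import Data.Rational.Properties using (fromℚᵘ-cong; toℚᵘ-fromℚᵘ; toℚᵘ-injective; toℚᵘ-homo-+)
  import Data.Rational.Unnormalised as ℚᵘ
  import Data.Rational.Unnormalised.Properties as ℚᵘ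
  open import Relation.Binary.PropositionalEquality

  fromℚᵘ-/ : ∀ i d .{{_ : ℕ.NonZero d}} → fromℚᵘ (i ℚᵘ./ d) ≡ i / d
  fromℚᵘ-/ i (suc _) = refl

  toℚᵘ-/ : ∀ i d .{{_ : ℕ.NonZero d}} → toℚᵘ (i / d) ℚᵘ.≃ i ℚᵘ./ d
  toℚᵘ-/ i d = subst (λ x → toℚᵘ x ℚᵘ.≃ i ℚᵘ./ d) (fromℚᵘ-/ i d) (toℚᵘ-fromℚᵘ (i ℚᵘ./ d))

  /-cancelˡ : ∀ p i d .{{_ : ℕ.NonZero d}} .{{_ : ℕ.NonZero (p ℕ.* d)}} →
              (+ p ℤ.* i) / (p ℕ.* d) ≡ i / d
  /-cancelˡ p i d = begin
    (+ p ℤ.* i) / (p ℕ.* d)                ≡⟨ fromℚᵘ-/ (+ p ℤ.* i) (p ℕ.* d) ⟨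
    fromℚᵘ ((+ p ℤ.* i) ℚᵘ./ (p ℕ.* d))    ≡⟨ fromℚᵘ-cong (ℚᵘ.*-cancelˡ-/ p) ⟩
    fromℚᵘ (i ℚᵘ./ d)                       ≡⟨ fromℚᵘ-/ i d ⟩
    i / d                                   ∎
    where open ≡-Reasoning

  /-distribʳ-+ : ∀ i j d .{{_ : ℕ.NonZero d}} → (i ℤ.+ j) / d ≡ i / d + j / d
  /-distribʳ-+ i j d@(suc _) = toℚᵘ-injective (begin
    toℚᵘ ((i ℤ.+ j) / d)                          ≈⟨ toℚᵘ-/ (i ℤ.+ j) d ⟩
    (i ℤ.+ j) ℚᵘ./ d                              ≈⟨ ℚᵘ.*-cancelʳ-/ d ⟨
    ((i ℤ.+ j) ℤ.* + d) ℚᵘ./ (d ℕ.* d)            ≡⟨ ℚᵘ./-cong (ℤ.*-distribʳ-+ (+ d) i j) refl ⟩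
    (i ℤ.* + d ℤ.+ j ℤ.* + d) ℚᵘ./ (d ℕ.* d)      ≡⟨⟩
    i ℚᵘ./ d ℚᵘ.+ j ℚᵘ./ d                        ≈⟨ ℚᵘ.+-cong (toℚᵘ-/ i d) (toℚᵘ-/ j d) ⟨
    toℚᵘ (i / d) ℚᵘ.+ toℚᵘ (j / d)                ≈⟨ toℚᵘ-homo-+ (i / d) (j / d) ⟨
    toℚᵘ (i / d + j / d)                          ∎)
    where open ℚᵘ.≃-Reasoning

module RationalSequences where

  open import Data.Nat as ℕ using (ℕ; zero; suc)
  import Data.Nat.Properties as ℕ
  open import Data.Rational as ℚ using (ℚ; 0ℚ; 1ℚ; ½; _+_; _-_; -_; _*_; _≤_; _<_; ∣_∣)
  open import Data.Rational.Properties
  open import Data.Rational.Solver using (module +-*-Solver)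
  open import Data.Product using (_×_; _,_; ∃)
  open import Data.Sum using (inj₁; inj₂)
  open import Relation.Binary.PropositionalEquality

  open import Defs using (Σ₁; TendsTo; IsCauchy)
  open +-*-Solver

  p≤p+q : ∀ {p q} → 0ℚ ≤ q → p ≤ p + q
  p≤p+q {p} 0≤q = subst (_≤ p + _) (+-identityʳ p) (+-monoʳ-≤ p 0≤q)

  p≤q+p : ∀ {p q} → 0ℚ ≤ q → p ≤ q + p
  p≤q+p {p} {q} 0≤q = subst (p ≤_) (+-comm p q) (p≤p+q 0≤q)

  p≤q⇒0≤q-p : ∀ {p q} → p ≤ q → 0ℚ ≤ q - p
  p≤q⇒0≤q-p {p} {q} p≤q = subst (_≤ q - p) (+-inverseʳ p) (+-monoˡ-≤ (- p) p≤q)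

  *-nonNeg : ∀ {p q} → 0ℚ ≤ p → 0ℚ ≤ q → 0ℚ ≤ p * q
  *-nonNeg {p} {q} 0≤p 0≤q =
    nonNegative⁻¹ _ {{nonNeg*nonNeg⇒nonNeg p {{ℚ.nonNegative 0≤p}} q {{ℚ.nonNegative 0≤q}}}}

  ∣p-0∣≡p : ∀ {p} → 0ℚ ≤ p → ∣ p - 0ℚ ∣ ≡ p
  ∣p-0∣≡p {p} 0≤p = trans (cong ∣_∣ (+-identityʳ p)) (0≤p⇒∣p∣≡p 0≤p)

  ∣p-q∣≡∣q-p∣ : ∀ p q → ∣ p - q ∣ ≡ ∣ q - p ∣
  ∣p-q∣≡∣q-p∣ p q =
    trans (cong ∣_∣ (solve 2 (λ x y → x :- y := :- (y :- x)) refl p q)) (∣-p∣≡∣p∣ (q - p))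

  Σ₁-mono-≤ : ∀ {f} → (∀ k → 0ℚ ≤ f k) → ∀ {j k} → j ℕ.≤ k → Σ₁ f j ≤ Σ₁ f k
  Σ₁-mono-≤ {f} f≥0 j≤k = go (ℕ.≤⇒≤′ j≤k)
    where
    go : ∀ {j k} → j ℕ.≤′ k → Σ₁ f j ≤ Σ₁ f k
    go ℕ.≤′-refl        = ≤-refl
    go (ℕ.≤′-step j≤′k) = ≤-trans (go j≤′k) (p≤p+q (f≥0 _))

  module _ {s : ℕ → ℚ} (s≥0 : ∀ k → 0ℚ ≤ s k) (s→0 : TendsTo s 0ℚ) where

    eventually-< : ∀ ε → 0ℚ < ε → ∃ λ N → ∀ k → N ℕ.≤ k → s k < ε
    eventually-< ε ε>0 with s→0 ε ε>0
    ... | N , close = N , λ k N≤k → subst (_< ε) (∣p-0∣≡p (s≥0 k)) (close k N≤k)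

    TendsTo-0-dominated : ∀ {t} → (∀ k → ∣ t k - 0ℚ ∣ ≤ s k) → TendsTo t 0ℚ
    TendsTo-0-dominated t≤s ε ε>0 with eventually-< ε ε>0
    ... | N , small = N , λ k N≤k → ≤-<-trans (t≤s k) (small k N≤k)

    tail-bounded⇒IsCauchy : ∀ {u} → (∀ {j k} → j ℕ.≤ k → 0ℚ ≤ u k - u j × u k - u j ≤ s j) →
                            IsCauchy u
    tail-bounded⇒IsCauchy {u} tail ε ε>0 with eventually-< ε ε>0
    ... | N , small = N , close
      where
      ordered : ∀ {j k} → j ℕ.≤ k → N ℕ.≤ j → ∣ u k - u j ∣ < ε
      ordered j≤k N≤j with tail j≤k
      ... | 0≤Δ , Δ≤s = subst (_< ε) (sym (0≤p⇒∣p∣≡p 0≤Δ)) (≤-<-trans Δ≤s (small _ N≤j))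

      close : ∀ j k → N ℕ.≤ j → N ℕ.≤ k → ∣ u j - u k ∣ < ε
      close j k N≤j N≤k with ℕ.≤-total j k
      ... | inj₁ j≤k = subst (_< ε) (∣p-q∣≡∣q-p∣ (u k) (u j)) (ordered j≤k N≤j)
      ... | inj₂ k≤j = ordered k≤j N≤k

  module SplitSequence (Q R : ℕ → ℚ) (Q-split : ∀ k → Q k ≡ Q (suc k) + R (suc k)) where

    P R² : ℕ → ℚ
    P  = Σ₁ (λ k → Q k * R k)
    R² = Σ₁ (λ k → R k * R k)

    squares-telescope : ∀ N → P N + P N + R² N + Q N * Q N ≡ Q 0 * Q 0
    squares-telescope zero    =
      solve 1 (λ x → con 0ℚ :+ con 0ℚ :+ con 0ℚ :+ x :* x := x :* x) refl (Q 0)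
    squares-telescope (suc N) = begin
      (P N + q′ * r′) + (P N + q′ * r′) + (R² N + r′ * r′) + q′ * q′
        ≡⟨ solve 4 (λ p s q r → (p :+ q :* r) :+ (p :+ q :* r) :+ (s :+ r :* r) :+ q :* q
                              := p :+ p :+ s :+ (q :+ r) :* (q :+ r)) refl (P N) (R² N) q′ r′ ⟩
      P N + P N + R² N + (q′ + r′) * (q′ + r′)
        ≡⟨ cong (λ x → P N + P N + R² N + x * x) (Q-split N) ⟨
      P N + P N + R² N + Q N * Q N
        ≡⟨ squares-telescope N ⟩
      Q 0 * Q 0 ∎
      where
      open ≡-Reasoning
      q′ r′ : ℚ
      q′ = Q (suc N)
      r′ = R (suc N)

    squares-telescope-tail : ∀ j k →
      (P k - P j) + (P k - P j) + (R² k - R² j) + Q k * Q k ≡ Q j * Q j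
    squares-telescope-tail j k = begin
      (P k - P j) + (P k - P j) + (R² k - R² j) + Q k * Q k
        ≡⟨ solve 6 (λ pk pj sk sj qk qj →
             (pk :- pj) :+ (pk :- pj) :+ (sk :- sj) :+ qk :* qk
               := (pk :+ pk :+ sk :+ qk :* qk) :- (pj :+ pj :+ sj :+ qj :* qj) :+ qj :* qj)
             refl (P k) (P j) (R² k) (R² j) (Q k) (Q j) ⟩
      (P k + P k + R² k + Q k * Q k) - (P j + P j + R² j + Q j * Q j) + Q j * Q j
        ≡⟨ cong₂ (λ x y → x - y + Q j * Q j) (squares-telescope k) (squares-telescope j) ⟩
      Q 0 * Q 0 - Q 0 * Q 0 + Q j * Q j
        ≡⟨ solve 2 (λ x y → x :- x :+ y := y) refl (Q 0 * Q 0) (Q j * Q j) ⟩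
      Q j * Q j ∎
      where open ≡-Reasoning

    module Normalised (Q≥0 : ∀ k → 0ℚ ≤ Q k) (R≥0 : ∀ k → 0ℚ ≤ R k) (Q0≡1 : Q 0 ≡ 1ℚ) where

      Q≤1 : ∀ k → Q k ≤ 1ℚ
      Q≤1 zero    = ≤-reflexive Q0≡1
      Q≤1 (suc k) = ≤-trans (subst (Q (suc k) ≤_) (sym (Q-split k)) (p≤p+q (R≥0 (suc k))))
                            (Q≤1 k)

      Q²≤Q : ∀ k → Q k * Q k ≤ Q k
      Q²≤Q k = subst (Q k * Q k ≤_) (*-identityʳ (Q k))
                 (*-monoˡ-≤-nonNeg (Q k) {{ℚ.nonNegative (Q≥0 k)}} (Q≤1 k))

      P-mono : ∀ {j k} → j ℕ.≤ k → P j ≤ P k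
      P-mono = Σ₁-mono-≤ (λ i → *-nonNeg (Q≥0 i) (R≥0 i))

      R²-mono : ∀ {j k} → j ℕ.≤ k → R² j ≤ R² k
      R²-mono = Σ₁-mono-≤ (λ i → *-nonNeg (R≥0 i) (R≥0 i))

      tail-sum≤Q : ∀ j k → (P k - P j) + (P k - P j) + (R² k - R² j) ≤ Q j
      tail-sum≤Q j k = begin
        (P k - P j) + (P k - P j) + (R² k - R² j)              ≤⟨ p≤p+q (*-nonNeg (Q≥0 k) (Q≥0 k)) ⟩
        (P k - P j) + (P k - P j) + (R² k - R² j) + Q k * Q k  ≡⟨ squares-telescope-tail j k ⟩
        Q j * Q j                                              ≤⟨ Q²≤Q j ⟩
        Q j                                                    ∎
        where open ≤-Reasoning

      P-tail : ∀ {j k} → j ℕ.≤ k → 0ℚ ≤ P k - P j × P k - P j ≤ Q j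
      P-tail {j} {k} j≤k = 0≤ΔP , ≤-trans (≤-trans (p≤p+q 0≤ΔP) (p≤p+q 0≤ΔR²)) (tail-sum≤Q j k)
        where
        0≤ΔP = p≤q⇒0≤q-p (P-mono j≤k)
        0≤ΔR² = p≤q⇒0≤q-p (R²-mono j≤k)

      R²-tail : ∀ {j k} → j ℕ.≤ k → 0ℚ ≤ R² k - R² j × R² k - R² j ≤ Q j
      R²-tail {j} {k} j≤k = 0≤ΔR² , ≤-trans (p≤q+p (+-mono-≤ 0≤ΔP 0≤ΔP)) (tail-sum≤Q j k)
        where
        0≤ΔP = p≤q⇒0≤q-p (P-mono j≤k)
        0≤ΔR² = p≤q⇒0≤q-p (R²-mono j≤k)

      P-error : ∀ N → (P N - (½ - ½ * R² N)) - 0ℚ ≡ - (½ * (Q N * Q N))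
      P-error N = begin
        (P N - (½ - ½ * R² N)) - 0ℚ
          ≡⟨ solve 3 (λ p s q → (p :- (con ½ :- con ½ :* s)) :- con 0ℚ
                               := con ½ :* (p :+ p :+ s :+ q :* q) :- con ½ :- con ½ :* (q :* q))
                     refl (P N) (R² N) (Q N) ⟩
        ½ * (P N + P N + R² N + Q N * Q N) - ½ - ½ * (Q N * Q N)
          ≡⟨ cong (λ x → ½ * x - ½ - ½ * (Q N * Q N))
                  (trans (squares-telescope N) (cong (λ x → x * x) Q0≡1)) ⟩
        ½ * (1ℚ * 1ℚ) - ½ - ½ * (Q N * Q N)
          ≡⟨ solve 1 (λ x → con ½ :* (con 1ℚ :* con 1ℚ) :- con ½ :- x := :- x)
                     refl (½ * (Q N * Q N)) ⟩
        - (½ * (Q N * Q N)) ∎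
        where open ≡-Reasoning

      ∣P-error∣≤Q : ∀ N → ∣ (P N - (½ - ½ * R² N)) - 0ℚ ∣ ≤ Q N
      ∣P-error∣≤Q N = begin
        ∣ (P N - (½ - ½ * R² N)) - 0ℚ ∣  ≡⟨ cong ∣_∣ (P-error N) ⟩
        ∣ - (½ * (Q N * Q N)) ∣          ≡⟨ ∣-p∣≡∣p∣ _ ⟩
        ∣ ½ * (Q N * Q N) ∣              ≡⟨ 0≤p⇒∣p∣≡p (*-nonNeg 0≤½ Q²≥0) ⟩
        ½ * (Q N * Q N)                  ≤⟨ p≤p+q (*-nonNeg 0≤½ Q²≥0) ⟩
        ½ * (Q N * Q N) + ½ * (Q N * Q N) ≡⟨ solve 1 (λ x → con ½ :* x :+ con ½ :* x := x) refl (Q N * Q N) ⟩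
        Q N * Q N                        ≤⟨ Q²≤Q N ⟩
        Q N                              ∎
        where
        open ≤-Reasoning
        Q²≥0 = *-nonNeg (Q≥0 N) (Q≥0 N)
        0≤½ : 0ℚ ≤ ½
        0≤½ = nonNegative⁻¹ ½

module Probabilities where

  open import Data.Nat as ℕ using (ℕ; suc; _^_; s≤s)
  open import Data.Nat.Properties using (m^n≢0)
  open import Data.Integer as ℤ using (ℤ; +_)
  import Data.Integer.Properties as ℤ
  open import Data.Rational as ℚ using (ℚ; _/_; 0ℚ; 1ℚ; _+_; _≤_)
  open import Data.Rational.Properties using (nonNegative⁻¹; normalize-nonNeg)
  open import Relation.Binary.PropositionalEquality
  open ≡-Reasoning

  open import Defs
  open PathCounts using (count-staysBelow-suc)
  open Fractions using (/-cancelˡ; /-distribʳ-+)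

  prob-nonNeg : ∀ k f → 0ℚ ≤ prob k f
  prob-nonNeg k f = nonNegative⁻¹ _ {{normalize-nonNeg (count f (paths k)) (2 ^ k) {{m^n≢0 2 k}}}}

  prob-staysBelow-suc : ∀ a b N s k → prob k (staysBelow a b N s) ≡
    prob (suc k) (staysBelow a b N s) + prob (suc k) (firstHits a b N s)
  prob-staysBelow-suc a b N s k = begin
    (+ C k) /2^ k
      ≡⟨ /-cancelˡ 2 (+ C k) (2 ^ k) {{m^n≢0 2 k}} {{m^n≢0 2 (suc k)}} ⟨
    (+ 2 ℤ.* + C k) /2^ suc k
      ≡⟨ cong (_/2^ suc k) two-C≡C+F ⟩
    (+ C (suc k) ℤ.+ + F (suc k)) /2^ suc k
      ≡⟨ /-distribʳ-+ (+ C (suc k)) (+ F (suc k)) (2 ^ suc k) {{m^n≢0 2 (suc k)}} ⟩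
    (+ C (suc k)) /2^ suc k + (+ F (suc k)) /2^ suc k ∎
    where
    _/2^_ : ℤ → ℕ → ℚ
    i /2^ k = (i / 2 ^ k) {{m^n≢0 2 k}}
    C F : ℕ → ℕ
    C k = count (staysBelow a b N s) (paths k)
    F k = count (firstHits a b N s) (paths k)
    two-C≡C+F : + 2 ℤ.* + C k ≡ + C (suc k) ℤ.+ + F (suc k)
    two-C≡C+F = begin
      + 2 ℤ.* + C k                 ≡⟨ ℤ.pos-* 2 (C k) ⟨
      + (2 ℕ.* C k)                 ≡⟨ cong +_ (count-staysBelow-suc a b N s k) ⟩
      + (C (suc k) ℕ.+ F (suc k))   ≡⟨ ℤ.pos-+ (C (suc k)) (F (suc k)) ⟩
      + C (suc k) ℤ.+ + F (suc k)   ∎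

  q-zero : ∀ a b {n} → 1 ℕ.≤ n → q a b n 0 ≡ 1ℚ
  q-zero a b (s≤s _) = refl

open import Defs
open import Data.Nat using (ℕ; _≤_)
open import Data.Integer using (ℤ; +_)
open import Data.Rational using (ℚ; 0ℚ; ½; _-_; _*_)
import Data.Rational as ℚ
open import Data.Product using (_×_; _,_)
open RationalSequences
open Probabilities

theorem1 : (a b : ℤ) (n : ℕ) → 1 ≤ n →
    TendsTo (q a b n) 0ℚ →
    IsCauchy (pPartial a b n) × IsCauchy (r²Partial a b n) ×
      TendsTo (λ N → pPartial a b n N - (½ - ½ * r²Partial a b n N)) 0ℚ
theorem1 a b n 1≤n q→0 =
    tail-bounded⇒IsCauchy q≥0 q→0 {P} P-tail
  , tail-bounded⇒IsCauchy q≥0 q→0 {R²} R²-tail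
  , TendsTo-0-dominated q≥0 q→0 {λ N → P N - (½ - ½ * R² N)} ∣P-error∣≤Q
  where
  q≥0 : ∀ k → 0ℚ ℚ.≤ q a b n k
  q≥0 k = prob-nonNeg k (staysBelow a b (+ n) (+ 0))
  open SplitSequence (q a b n) (r a b n) (prob-staysBelow-suc a b (+ n) (+ 0))
  open Normalised q≥0 (λ k → prob-nonNeg k (firstHits a b (+ n) (+ 0))) (q-zero a b 1≤n)
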